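{- Let $p$ be a prime and let $q=p^\alpha$ with $\alpha\geq 1$ an integer. Let $n,s$ be positive integers. Then $m(n,s,q)\leq \sum_{j=0}^{q-1}\binom{n}{j}$.
   Context: For a family $\mathcal F$ of subsets of $[n]=\{1,\ldots,n\}$ and $L\subseteq\{0,\ldots,q-1\}$: $\mathcal F$ is $L$-avoiding mod $q$ if for every $F\in\mathcal F$, $|F|\not\equiv\ell\pmod q$ for all $\ell\in L$; $\mathcal F$ is $L$-intersecting mod $q$ if for all distinct $E,F\in\mathcal F$ there is $\ell\in L$ with $|E\cap F|\equiv \ell\pmod q$. $m(n,s,q)$ denotes the smallest integer such that for every set $L\subseteq\{0,\ldots,q-1\}$ with $|L|=s$, every family of subsets of $[n]$ that is both $L$-avoiding mod $q$ and $L$-intersecting mod $q$ has at most $m(n,s,q)$ members. -}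

module Defs where

open import Data.Nat using (ℕ; zero; suc; _+_; _<_; _^_; _≥_; NonZero)
open import Data.Nat.DivMod using (_%_)
open import Data.Nat.Combinatorics using (_C_)
open import Data.Fin.Subset using (Subset; ∣_∣; _∩_)
open import Data.List using (List; length)
open import Data.List.Membership.Propositional using (_∈_)
open import Data.List.Relation.Unary.All using (All)
open import Data.List.Relation.Unary.Any using (Any)
open import Data.List.Relation.Unary.Unique.Propositional using (Unique)
open import Data.Product using (Σ; _×_)
open import Relation.Binary.PropositionalEquality using (_≡_; _≢_)
open import Relation.Nullary using (¬_)

_≡[mod_]_ : ℕ → (q : ℕ) → .{{NonZero q}} → ℕ → Set
a ≡[mod q ] b = a % q ≡ b % q

ResidueSet : (q s : ℕ) → List ℕ → Set
ResidueSet q s L = All (_< q) L × Unique L × length L ≡ s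

LAvoiding : ∀ {n} (q : ℕ) .{{_ : NonZero q}} → List ℕ → List (Subset n) → Set
LAvoiding q L 𝓕 = ∀ F → F ∈ 𝓕 → ∀ ℓ → ℓ ∈ L → ¬ (∣ F ∣ ≡[mod q ] ℓ)

LIntersecting : ∀ {n} (q : ℕ) .{{_ : NonZero q}} → List ℕ → List (Subset n) → Set
LIntersecting q L 𝓕 =
  ∀ E F → E ∈ 𝓕 → F ∈ 𝓕 → E ≢ F → Any (λ ℓ → ∣ E ∩ F ∣ ≡[mod q ] ℓ) L

sumBinom< : ℕ → ℕ → ℕ
sumBinom< n zero = 0
sumBinom< n (suc k) = sumBinom< n k + n C k

-- Statement "m(n,s,q) ≤ b": every family (a duplicate-free list of subsets
-- of [n]) that is L-avoiding and L-intersecting mod q, for any L ⊆ {0..q-1}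
-- with |L| = s, has at most b members.
m≤ : (n s q : ℕ) .{{_ : NonZero q}} → ℕ → Set
m≤ n s q b = ∀ (L : List ℕ) → ResidueSet q s L →
  ∀ (𝓕 : List (Subset n)) → Unique 𝓕 →
  LAvoiding q L 𝓕 → LIntersecting q L 𝓕 → length 𝓕 Data.Nat.≤ b

{-# OPTIONS --safe #-}

-- For each member F of the family choose c_F with |F| + c_F ≡ -1 (mod q) and
-- consider the matrix M(E,F) = C(|E ∩ F| + c_E, q - 1).  Vandermonde's identity together with
-- p ∣ C(q, i) for 0 < i < q gives C(x + q, j) ≡ C(x, j) (mod p) for j < q, so C(y, q - 1) is prime
-- to p exactly when y ≡ -1 (mod q).  Being L-avoiding and L-intersecting forces |E ∩ F| ≢ |E|
-- (mod q) for E ≠ F, so M is diagonal modulo p with diagonal entries prime to p, i.e. invertible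
-- over 𝔽_p.  Expanding M by Vandermonde again over the sets S ⊆ E ∩ F with |S| < q factors it
-- as A Bᵀ with A(E,S) = C(c_E, q - 1 - |S|) [S ⊆ E] and B(F,S) = [S ⊆ F], so its rank over 𝔽_p,
-- and hence the size of the family, is at most the number Σ_{j<q} C(n, j) of such S.  The rank
-- bound is proved by Gaussian elimination modulo p.

module Submission where

open import Data.Nat
open import Data.Nat.Properties
open import Data.Nat.Divisibility
open import Data.Nat.DivMod
open import Data.Nat.Primality using (Prime; prime⇒nonZero; prime⇒nonTrivial; euclidsLemma)
open import Data.Nat.Combinatorics using (_C_; nCk+nC[k+1]≡[n+1]C[k+1]; nC1≡n; nCn≡1)
open import Data.Nat.Combinatorics.Specification using (k>n⇒nCk≡0)
open import Data.Nat.ListAction using (sum)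
open import Data.Nat.ListAction.Properties using (sum-++)
open import Data.Nat.Tactic.RingSolver using (solve-∀)
open import Data.Fin using (Fin; zero; suc; punchIn)
open import Data.Fin.Properties using (all?; ¬∀⟶∃¬; punchIn-injective; punchInᵢ≢i)
open import Data.Fin.Subset using (Subset; inside; outside; ⊥; _∩_)
open import Data.Fin.Subset.Properties using (∩-idem)
open import Data.Vec using ([]; _∷_)
open import Data.List using (List; []; _∷_; [_]; _++_; _∷ʳ_; applyUpTo; map; length; lookup)
open import Data.List.Properties using (applyUpTo-∷ʳ; map-++; map-∘; map-cong; length-++; length-map)
open import Data.List.Membership.Propositional using (_∈_; find)
open import Data.List.Membership.Propositional.Properties using (∈-lookup)
import Data.List.Relation.Unary.All as All
open import Data.List.Relation.Unary.AllPairs using (_∷_)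
open import Data.List.Relation.Unary.Unique.Propositional using (Unique)
open import Data.Product using (_×_; _,_)
open import Data.Sum using (inj₁; inj₂; [_,_]′)
open import Function using (_∘_)
open import Function.Bundles using (_⇔_; mk⇔; Equivalence)
import Function.Properties.Equivalence as ⇔
open import Function.Related.TypeIsomorphisms using (¬-cong-⇔)
open import Relation.Nullary using (¬_; yes; no; contradiction)
open import Relation.Binary.PropositionalEquality
  using (_≡_; _≢_; refl; sym; trans; cong; cong₂; subst; subst₂; module ≡-Reasoning)
open import Algebra.Properties.CommutativeSemigroup +-commutativeSemigroup using (interchange; x∙yz≈xz∙y)
import Algebra.Properties.CommutativeSemigroup *-commutativeSemigroup as *-Properties

open import Defs

open ≡-Reasoning

sum-applyUpTo-∷ʳ : ∀ (f : ℕ → ℕ) t → sum (applyUpTo f (suc t)) ≡ sum (applyUpTo f t) + f t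
sum-applyUpTo-∷ʳ f t = begin
  sum (applyUpTo f (suc t))        ≡⟨ cong sum (applyUpTo-∷ʳ f t) ⟨
  sum (applyUpTo f t ∷ʳ f t)       ≡⟨ sum-++ (applyUpTo f t) _ ⟩
  sum (applyUpTo f t) + (f t + 0)  ≡⟨ cong (sum (applyUpTo f t) +_) (+-identityʳ (f t)) ⟩
  sum (applyUpTo f t) + f t        ∎

sum-applyUpTo-cong : ∀ {f g : ℕ → ℕ} t → (∀ i → f i ≡ g i) → sum (applyUpTo f t) ≡ sum (applyUpTo g t)
sum-applyUpTo-cong zero    f≗g = refl
sum-applyUpTo-cong (suc t) f≗g = cong₂ _+_ (f≗g 0) (sum-applyUpTo-cong t (f≗g ∘ suc))

sum-applyUpTo-+ : ∀ (f g : ℕ → ℕ) t →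
  sum (applyUpTo (λ i → f i + g i) t) ≡ sum (applyUpTo f t) + sum (applyUpTo g t)
sum-applyUpTo-+ f g zero    = refl
sum-applyUpTo-+ f g (suc t) = trans (cong (f 0 + g 0 +_) (sum-applyUpTo-+ (f ∘ suc) (g ∘ suc) t))
                                    (interchange (f 0) (g 0) _ _)

sum-applyUpTo-0 : ∀ t → sum (applyUpTo (λ _ → 0) t) ≡ 0
sum-applyUpTo-0 zero    = refl
sum-applyUpTo-0 (suc t) = sum-applyUpTo-0 t

∣-sum-applyUpTo : ∀ {d} (f : ℕ → ℕ) t → (∀ {i} → i < t → d ∣ f i) → d ∣ sum (applyUpTo f t)
∣-sum-applyUpTo f zero    d∣f = _ ∣0
∣-sum-applyUpTo f (suc t) d∣f = ∣m∣n⇒∣m+n (d∣f z<s) (∣-sum-applyUpTo (f ∘ suc) t (d∣f ∘ s<s))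

sum-map-++ : ∀ {A : Set} (f : A → ℕ) xs ys → sum (map f (xs ++ ys)) ≡ sum (map f xs) + sum (map f ys)
sum-map-++ f xs ys = trans (cong sum (map-++ f xs ys)) (sum-++ (map f xs) (map f ys))

sum-map-* : ∀ {A : Set} c (f : A → ℕ) xs → sum (map (λ x → c * f x) xs) ≡ c * sum (map f xs)
sum-map-* c f []       = sym (*-zeroʳ c)
sum-map-* c f (x ∷ xs) = trans (cong (c * f x +_) (sum-map-* c f xs)) (sym (*-distribˡ-+ c (f x) _))

sum-map-0 : ∀ {A : Set} (xs : List A) → sum (map (λ _ → 0) xs) ≡ 0
sum-map-0 []       = refl
sum-map-0 (x ∷ xs) = sum-map-0 xs

[1+k]*[1+n]C[1+k]≡[1+n]*nCk : ∀ n k → suc k * (suc n C suc k) ≡ suc n * (n C k)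
[1+k]*[1+n]C[1+k]≡[1+n]*nCk zero    zero    = refl
[1+k]*[1+n]C[1+k]≡[1+n]*nCk zero    (suc k) = *-zeroʳ (suc (suc k))
[1+k]*[1+n]C[1+k]≡[1+n]*nCk (suc n) zero    =
  trans (+-identityʳ _) (trans (nC1≡n (suc (suc n))) (sym (*-identityʳ _)))
[1+k]*[1+n]C[1+k]≡[1+n]*nCk (suc n) (suc k) = begin
  suc (suc k) * (suc (suc n) C suc (suc k))   ≡⟨ cong (suc (suc k) *_) (nCk+nC[k+1]≡[n+1]C[k+1] (suc n) (suc k)) ⟨
  suc (suc k) * (X + Y)                       ≡⟨ *-distribˡ-+ (suc (suc k)) X Y ⟩
  X + suc k * X + suc (suc k) * Y             ≡⟨ cong₂ (λ u v → X + u + v) ([1+k]*[1+n]C[1+k]≡[1+n]*nCk n k)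
                                                                        ([1+k]*[1+n]C[1+k]≡[1+n]*nCk n (suc k)) ⟩
  X + suc n * (n C k) + suc n * (n C suc k)   ≡⟨ +-assoc X _ _ ⟩
  X + (suc n * (n C k) + suc n * (n C suc k)) ≡⟨ cong (X +_) (*-distribˡ-+ (suc n) (n C k) (n C suc k)) ⟨
  X + suc n * (n C k + n C suc k)             ≡⟨ cong (λ z → X + suc n * z) (nCk+nC[k+1]≡[n+1]C[k+1] n k) ⟩
  X + suc n * X                               ∎
  where
  X = suc n C suc k
  Y = suc n C suc (suc k)

-- Unfolding a sum below exposes its i = 0 summand (x C 0) * (c C _) in the normal form c C _ + 0.
vandermonde : ∀ x c m → sum (applyUpTo (λ i → (x C i) * (c C (m ∸ i))) (suc m)) ≡ (x + c) C m
vandermonde zero    c m       = begin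
  c C m + 0 + sum (applyUpTo (λ _ → 0) m)  ≡⟨ cong₂ _+_ (+-identityʳ (c C m)) (sum-applyUpTo-0 m) ⟩
  c C m + 0                                ≡⟨ +-identityʳ (c C m) ⟩
  c C m                                    ∎
vandermonde (suc x) c zero    = refl
vandermonde (suc x) c (suc m) = begin
  c C suc m + 0 + sum (applyUpTo (λ i → (suc x C suc i) * (c C (m ∸ i))) (suc m))
    ≡⟨ cong (c C suc m + 0 +_) (sum-applyUpTo-cong (suc m) pascal-distrib) ⟩
  c C suc m + 0 + sum (applyUpTo (λ i → f i + g i) (suc m))
    ≡⟨ cong (c C suc m + 0 +_) (sum-applyUpTo-+ f g (suc m)) ⟩
  c C suc m + 0 + (sum (applyUpTo f (suc m)) + sum (applyUpTo g (suc m)))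
    ≡⟨ x∙yz≈xz∙y (c C suc m + 0) _ _ ⟩
  c C suc m + 0 + sum (applyUpTo g (suc m)) + sum (applyUpTo f (suc m))
    ≡⟨ cong₂ _+_ (vandermonde x c (suc m)) (vandermonde x c m) ⟩
  (x + c) C suc m + (x + c) C m
    ≡⟨ +-comm ((x + c) C suc m) _ ⟩
  (x + c) C m + (x + c) C suc m
    ≡⟨ nCk+nC[k+1]≡[n+1]C[k+1] (x + c) m ⟩
  suc (x + c) C suc m
    ∎
  where
  f g : ℕ → ℕ
  f i = (x C i) * (c C (m ∸ i))
  g i = (x C suc i) * (c C (m ∸ i))
  pascal-distrib : ∀ i → (suc x C suc i) * (c C (m ∸ i)) ≡ f i + g i
  pascal-distrib i = trans (cong (_* (c C (m ∸ i))) (sym (nCk+nC[k+1]≡[n+1]C[k+1] x i)))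
                           (*-distribʳ-+ (c C (m ∸ i)) (x C i) (x C suc i))

module _ {q} .{{_ : NonZero q}} where

  +-congʳ-≡[mod] : ∀ a b c → a ≡[mod q ] b → (a + c) ≡[mod q ] (b + c)
  +-congʳ-≡[mod] a b c a≡b = begin
    (a + c) % q          ≡⟨ %-distribˡ-+ a c q ⟩
    (a % q + c % q) % q  ≡⟨ cong (λ z → (z + c % q) % q) a≡b ⟩
    (b % q + c % q) % q  ≡⟨ %-distribˡ-+ b c q ⟨
    (b + c) % q          ∎

  +-cancelʳ-≡[mod] : ∀ a b c → (a + c) ≡[mod q ] (b + c) → a ≡[mod q ] b
  +-cancelʳ-≡[mod] a b c a+c≡b+c = begin
    a % q                     ≡⟨ [m+kn]%n≡m%n a c q ⟨
    (a + c * q) % q           ≡⟨ cong (_% q) (+c*q≡+c+c*[q-1] a) ⟩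
    (a + c + c * pred q) % q  ≡⟨ +-congʳ-≡[mod] (a + c) (b + c) (c * pred q) a+c≡b+c ⟩
    (b + c + c * pred q) % q  ≡⟨ cong (_% q) (+c*q≡+c+c*[q-1] b) ⟨
    (b + c * q) % q           ≡⟨ [m+kn]%n≡m%n b c q ⟩
    b % q                     ∎
    where
    +c*q≡+c+c*[q-1] : ∀ x → x + c * q ≡ x + c + c * pred q
    +c*q≡+c+c*[q-1] x = begin
      x + c * q                 ≡⟨ cong (λ z → x + c * z) (suc-pred q) ⟨
      x + c * suc (pred q)      ≡⟨ cong (x +_) (*-suc c (pred q)) ⟩
      x + (c + c * pred q)      ≡⟨ +-assoc x c _ ⟨
      x + c + c * pred q        ∎

offset : ℕ → ℕ → ℕ
offset m y = m ∸ y % suc m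

+offset≡[mod]m : ∀ m y → (y + offset m y) ≡[mod suc m ] m
+offset≡[mod]m m y = begin
  (y + offset m y) % suc m         ≡⟨ +-congʳ-≡[mod] y (y % suc m) (offset m y) (sym (m%n%n≡m%n y (suc m))) ⟩
  (y % suc m + offset m y) % suc m ≡⟨ cong (_% suc m) (m+[n∸m]≡n (≤-pred (m%n<n y (suc m)))) ⟩
  m % suc m                        ∎

+offset≡[mod]m⇔≡[mod] : ∀ m x y → (x + offset m y) ≡[mod suc m ] m ⇔ x ≡[mod suc m ] y
+offset≡[mod]m⇔≡[mod] m x y = mk⇔
  (λ x+c≡m → +-cancelʳ-≡[mod] x y (offset m y) (trans x+c≡m (sym (+offset≡[mod]m m y))))
  (λ x≡y → trans (+-congʳ-≡[mod] x y (offset m y) x≡y) (+offset≡[mod]m m y))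

module _ {p} (pp : Prime p) where

  private instance
    p≢0 : NonZero p
    p≢0 = prime⇒nonZero pp

  p∤1 : ¬ p ∣ 1
  p∤1 p∣1 = nonTrivial⇒≢1 {{prime⇒nonTrivial pp}} (∣1⇒≡1 p∣1)

  p∤b∧pᵃ∣i*b⇒pᵃ∣i : ∀ {b} a i → ¬ p ∣ b → p ^ a ∣ i * b → p ^ a ∣ i
  p∤b∧pᵃ∣i*b⇒pᵃ∣i zero    i _   _      = 1∣ i
  p∤b∧pᵃ∣i*b⇒pᵃ∣i {b} (suc a) i p∤b pᵃ⁺¹∣ib with p∤b∧pᵃ∣i*b⇒pᵃ∣i a i p∤b (m*n∣⇒n∣ p (p ^ a) pᵃ⁺¹∣ib)
  ... | divides j refl = *-monoˡ-∣ (p ^ a) p∣j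
    where
    instance _ = m^n≢0 p a
    p∣j*b : p ∣ j * b
    p∣j*b = *-cancelˡ-∣ (p ^ a) (subst₂ _∣_ (*-comm p (p ^ a))
              (trans (*-assoc j (p ^ a) b) (*-Properties.x∙yz≈y∙xz j (p ^ a) b)) pᵃ⁺¹∣ib)
    p∣j : p ∣ j
    p∣j with euclidsLemma j b pp p∣j*b
    ... | inj₁ p∣j = p∣j
    ... | inj₂ p∣b = contradiction p∣b p∤b

  -- k C(q, k) = q C(q - 1, k - 1), so p ∤ C(q, k) would force q ∣ k.
  p∣[pᵅ]Ck : ∀ α {q k} → q ≡ p ^ α → 0 < k → k < q → p ∣ q C k
  p∣[pᵅ]Ck α {suc n} {suc k} q≡pᵅ _ k<q with p ∣? (suc n C suc k)
  ... | yes p∣C = p∣C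
  ... | no  p∤C = contradiction (subst (_≤ suc k) (sym q≡pᵅ) (∣⇒≤ pᵅ∣k)) (<⇒≱ k<q)
    where
    pᵅ∣kC : p ^ α ∣ suc k * (suc n C suc k)
    pᵅ∣kC = subst (_∣ _) q≡pᵅ
      (divides (n C k) (trans ([1+k]*[1+n]C[1+k]≡[1+n]*nCk n k) (*-comm (suc n) (n C k))))
    pᵅ∣k : p ^ α ∣ suc k
    pᵅ∣k = p∤b∧pᵃ∣i*b⇒pᵃ∣i α (suc k) p∤C pᵅ∣kC

  module _ (α : ℕ) {m} (1+m≡pᵅ : suc m ≡ p ^ α) where

    p∣[x+q]Cj⇔p∣xCj : ∀ x {j} → j < suc m → p ∣ (x + suc m) C j ⇔ p ∣ x C j
    p∣[x+q]Cj⇔p∣xCj x {j} j<q = mk⇔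
      (λ p∣lhs → ∣m+n∣m⇒∣n (subst (p ∣_) split p∣lhs) p∣lower)
      (λ p∣xCj → subst (p ∣_) (sym split) (∣m∣n⇒∣m+n p∣lower p∣xCj))
      where
      term : ℕ → ℕ
      term i = (x C i) * (suc m C (j ∸ i))
      last-term : term j ≡ x C j
      last-term = trans (cong (λ z → (x C j) * (suc m C z)) (n∸n≡0 j)) (*-identityʳ (x C j))
      split : (x + suc m) C j ≡ sum (applyUpTo term j) + x C j
      split = begin
        (x + suc m) C j                  ≡⟨ vandermonde x (suc m) j ⟨
        sum (applyUpTo term (suc j))     ≡⟨ sum-applyUpTo-∷ʳ term j ⟩
        sum (applyUpTo term j) + term j  ≡⟨ cong (sum (applyUpTo term j) +_) last-term ⟩
        sum (applyUpTo term j) + x C j   ∎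
      p∣lower : p ∣ sum (applyUpTo term j)
      p∣lower = ∣-sum-applyUpTo term j λ {i} i<j →
        ∣n⇒∣m*n (x C i) (p∣[pᵅ]Ck α 1+m≡pᵅ (m<n⇒0<n∸m i<j) (≤-<-trans (m∸n≤m j i) j<q))

    p∣[r+kq]Cj⇔p∣rCj : ∀ r k {j} → j < suc m → p ∣ (r + k * suc m) C j ⇔ p ∣ r C j
    p∣[r+kq]Cj⇔p∣rCj r zero    j<q rewrite +-identityʳ r = ⇔.refl
    p∣[r+kq]Cj⇔p∣rCj r (suc k) j<q rewrite x∙yz≈xz∙y r (suc m) (k * suc m) =
      ⇔.trans (p∣[x+q]Cj⇔p∣xCj (r + k * suc m) j<q) (p∣[r+kq]Cj⇔p∣rCj r k j<q)

    p∣yCm⇔p∣[y%q]Cm : ∀ y → p ∣ y C m ⇔ p ∣ (y % suc m) C m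
    p∣yCm⇔p∣[y%q]Cm y = subst (λ z → p ∣ z C m ⇔ p ∣ (y % suc m) C m)
      (sym (m≡m%n+[m/n]*n y (suc m))) (p∣[r+kq]Cj⇔p∣rCj (y % suc m) (y / suc m) ≤-refl)

    private
      m%q≡m : m % suc m ≡ m
      m%q≡m = m≤n⇒m%n≡m ≤-refl

    p∣yCm⇔y≢[mod]m : ∀ y → p ∣ y C m ⇔ (¬ y ≡[mod suc m ] m)
    p∣yCm⇔y≢[mod]m y with m≤n⇒m<n∨m≡n (≤-pred (m%n<n y (suc m)))
    ... | inj₁ r<m = ⇔.trans (p∣yCm⇔p∣[y%q]Cm y) (mk⇔
      (λ _ r≡m → <⇒≢ r<m (trans r≡m m%q≡m))
      (λ _ → subst (p ∣_) (sym (k>n⇒nCk≡0 r<m)) (p ∣0)))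
    ... | inj₂ r≡m = ⇔.trans (p∣yCm⇔p∣[y%q]Cm y) (mk⇔
      (λ p∣rCm → contradiction (subst (p ∣_) (trans (cong (_C m) r≡m) (nCn≡1 m)) p∣rCm) p∤1)
      (λ r≢m → contradiction (trans r≡m (sym m%q≡m)) r≢m))

    p∣[x+offset]Cm⇔x≢[mod]y : ∀ x y → p ∣ (x + offset m y) C m ⇔ (¬ x ≡[mod suc m ] y)
    p∣[x+offset]Cm⇔x≢[mod]y x y =
      ⇔.trans (p∣yCm⇔y≢[mod]m (x + offset m y)) (¬-cong-⇔ (+offset≡[mod]m⇔≡[mod] m x y))

module _ {K : Set} where

  dot : List K → (K → ℕ) → (K → ℕ) → ℕ
  dot ks u v = sum (map (λ k → u k * v k) ks)

  dot-linearʳ : ∀ (ks : List K) u v w x y →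
                dot ks u (λ k → x * v k + y * w k) ≡ x * dot ks u v + y * dot ks u w
  dot-linearʳ []       u v w x y = sym (cong₂ _+_ (*-zeroʳ x) (*-zeroʳ y))
  dot-linearʳ (k ∷ ks) u v w x y =
    trans (cong (u k * (x * v k + y * w k) +_) (dot-linearʳ ks u v w x y))
          (regroup (u k) x (v k) y (w k) (dot ks u v) (dot ks u w))
    where
    regroup : ∀ a b c d e f g → a * (b * c + d * e) + (b * f + d * g) ≡ b * (a * c + f) + d * (a * e + g)
    regroup = solve-∀

  record BiorthogonalMod (p : ℕ) (ks : List K) {m} (a b : Fin m → K → ℕ) : Set where
    field
      off-diagonal : ∀ {i j} → i ≢ j → p ∣ dot ks (a i) (b j)
      diagonal     : ∀ i → ¬ p ∣ dot ks (a i) (b i)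

  module _ {p} (pp : Prime p) where

    private instance
      p≢0 : NonZero p
      p≢0 = prime⇒nonZero pp

    p∣dot⇔p∣dot-∷ : ∀ k ks (u v : K → ℕ) → p ∣ u k * v k → p ∣ dot ks u v ⇔ p ∣ dot (k ∷ ks) u v
    p∣dot⇔p∣dot-∷ k ks u v p∣head = mk⇔ (∣m∣n⇒∣m+n p∣head) (λ p∣dot → ∣m+n∣m⇒∣n p∣dot p∣head)

    drop-null-coordinate : ∀ {k ks m} {a b : Fin m → K → ℕ} → (∀ j → p ∣ b j k) →
                           BiorthogonalMod p (k ∷ ks) a b → BiorthogonalMod p ks a b
    drop-null-coordinate {k} {ks} {a = a} {b} p∣b[k] bo = record
      { off-diagonal = λ {i} {j} i≢j → Equivalence.from (reduce i j) (off-diagonal i≢j)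
      ; diagonal     = λ i → diagonal i ∘ Equivalence.to (reduce i i)
      }
      where
      open BiorthogonalMod bo
      reduce : ∀ i j → p ∣ dot ks (a i) (b j) ⇔ p ∣ dot (k ∷ ks) (a i) (b j)
      reduce i j = p∣dot⇔p∣dot-∷ k ks (a i) (b j) (∣n⇒∣m*n (a i k) (p∣b[k] j))

    -- pred p stands for -1 modulo p, which makes the k-th coordinate vanish modulo p.
    eliminate : ∀ {m} → (Fin (suc m) → K → ℕ) → Fin (suc m) → K → Fin m → K → ℕ
    eliminate b j₀ k j k′ = pred p * b (punchIn j₀ j) k * b j₀ k′ + b j₀ k * b (punchIn j₀ j) k′

    p∣eliminate : ∀ {m} (b : Fin (suc m) → K → ℕ) j₀ k j → p ∣ eliminate b j₀ k j k
    p∣eliminate b j₀ k j = subst (p ∣_) (sym (begin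
      pred p * bⱼ * β + β * bⱼ    ≡⟨ cong (_+ β * bⱼ) (*-Properties.xy∙z≈x∙zy (pred p) bⱼ β) ⟩
      pred p * (β * bⱼ) + β * bⱼ  ≡⟨ +-comm (pred p * (β * bⱼ)) (β * bⱼ) ⟩
      suc (pred p) * (β * bⱼ)     ≡⟨ cong (_* (β * bⱼ)) (suc-pred p) ⟩
      p * (β * bⱼ)                ∎)) (m∣m*n (β * bⱼ))
      where
      β  = b j₀ k
      bⱼ = b (punchIn j₀ j) k

    eliminate-biorthogonal : ∀ {k ks m} {a b : Fin (suc m) → K → ℕ} j₀ → ¬ p ∣ b j₀ k →
      BiorthogonalMod p (k ∷ ks) a b → BiorthogonalMod p ks (a ∘ punchIn j₀) (eliminate b j₀ k)
    eliminate-biorthogonal {k} {ks} {m} {a} {b} j₀ p∤β bo = record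
      { off-diagonal = λ {i} {j} i≢j → Equivalence.from (reduce i j) (subst (p ∣_) (sym (expand i j))
          (∣m∣n⇒∣m+n (∣n⇒∣m*n (γ j) (p∣D[i,j₀] i))
                     (∣n⇒∣m*n β (off-diagonal (i≢j ∘ punchIn-injective j₀ i j)))))
      ; diagonal     = λ i p∣D → [ p∤β , diagonal (punchIn j₀ i) ]′ (euclidsLemma β _ pp
          (∣m+n∣m⇒∣n (subst (p ∣_) (expand i i) (Equivalence.to (reduce i i) p∣D))
                     (∣n⇒∣m*n (γ i) (p∣D[i,j₀] i))))
      }
      where
      open BiorthogonalMod bo
      a′ b′ : Fin m → K → ℕ
      a′ = a ∘ punchIn j₀
      b′ = eliminate b j₀ k
      β : ℕ
      β = b j₀ k
      γ : Fin m → ℕ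
      γ j = pred p * b (punchIn j₀ j) k
      p∣D[i,j₀] : ∀ i → p ∣ dot (k ∷ ks) (a′ i) (b j₀)
      p∣D[i,j₀] i = off-diagonal (punchInᵢ≢i j₀ i)
      reduce : ∀ i j → p ∣ dot ks (a′ i) (b′ j) ⇔ p ∣ dot (k ∷ ks) (a′ i) (b′ j)
      reduce i j = p∣dot⇔p∣dot-∷ k ks (a′ i) (b′ j) (∣n⇒∣m*n (a′ i k) (p∣eliminate b j₀ k j))
      expand : ∀ i j → dot (k ∷ ks) (a′ i) (b′ j)
                     ≡ γ j * dot (k ∷ ks) (a′ i) (b j₀) + β * dot (k ∷ ks) (a′ i) (b (punchIn j₀ j))
      expand i j = dot-linearʳ (k ∷ ks) (a′ i) (b j₀) (b (punchIn j₀ j)) (γ j) β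

    biorthogonal⇒m≤length : ∀ ks {m} {a b : Fin m → K → ℕ} → BiorthogonalMod p ks a b → m ≤ length ks
    biorthogonal⇒m≤length ks       {zero}  _  = z≤n
    biorthogonal⇒m≤length []       {suc m} bo = contradiction (p ∣0) (BiorthogonalMod.diagonal bo zero)
    biorthogonal⇒m≤length (k ∷ ks) {suc m} {a} {b} bo with all? (λ j → p ∣? b j k)
    ... | yes p∣b[k] = m≤n⇒m≤1+n (biorthogonal⇒m≤length ks (drop-null-coordinate p∣b[k] bo))
    ... | no ¬p∣b[k] with ¬∀⟶∃¬ _ _ (λ j → p ∣? b j k) ¬p∣b[k]
    ...   | j₀ , p∤b[j₀,k] = s≤s (biorthogonal⇒m≤length ks (eliminate-biorthogonal j₀ p∤b[j₀,k] bo))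

-- Imported only here: with ∣_∣ in scope, terms containing _∣_ twice no longer parse.
open import Data.Fin.Subset using (∣_∣)

⟦_⊆_⟧ : ∀ {n} → Subset n → Subset n → ℕ
⟦ []          ⊆ []          ⟧ = 1
⟦ inside  ∷ S ⊆ inside  ∷ X ⟧ = ⟦ S ⊆ X ⟧
⟦ inside  ∷ S ⊆ outside ∷ X ⟧ = 0
⟦ outside ∷ S ⊆ _       ∷ X ⟧ = ⟦ S ⊆ X ⟧

⟦⊥⊆X⟧≡1 : ∀ {n} (X : Subset n) → ⟦ ⊥ ⊆ X ⟧ ≡ 1
⟦⊥⊆X⟧≡1 []      = refl
⟦⊥⊆X⟧≡1 (_ ∷ X) = ⟦⊥⊆X⟧≡1 X

⟦S⊆E⟧*⟦S⊆F⟧≡⟦S⊆E∩F⟧ : ∀ {n} (S E F : Subset n) → ⟦ S ⊆ E ⟧ * ⟦ S ⊆ F ⟧ ≡ ⟦ S ⊆ E ∩ F ⟧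
⟦S⊆E⟧*⟦S⊆F⟧≡⟦S⊆E∩F⟧ []            []            []            = refl
⟦S⊆E⟧*⟦S⊆F⟧≡⟦S⊆E∩F⟧ (inside  ∷ S) (inside  ∷ E) (inside  ∷ F) = ⟦S⊆E⟧*⟦S⊆F⟧≡⟦S⊆E∩F⟧ S E F
⟦S⊆E⟧*⟦S⊆F⟧≡⟦S⊆E∩F⟧ (inside  ∷ S) (inside  ∷ E) (outside ∷ F) = *-zeroʳ ⟦ S ⊆ E ⟧
⟦S⊆E⟧*⟦S⊆F⟧≡⟦S⊆E∩F⟧ (inside  ∷ S) (outside ∷ E) (_       ∷ F) = refl
⟦S⊆E⟧*⟦S⊆F⟧≡⟦S⊆E∩F⟧ (outside ∷ S) (_       ∷ E) (_       ∷ F) = ⟦S⊆E⟧*⟦S⊆F⟧≡⟦S⊆E∩F⟧ S E F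

subsetsOfSize : ∀ n → ℕ → List (Subset n)
subsetsOfSize n       zero    = [ ⊥ ]
subsetsOfSize zero    (suc k) = []
subsetsOfSize (suc n) (suc k) = map (inside ∷_) (subsetsOfSize n k) ++ map (outside ∷_) (subsetsOfSize n (suc k))

length-subsetsOfSize : ∀ n k → length (subsetsOfSize n k) ≡ n C k
length-subsetsOfSize n       zero    = refl
length-subsetsOfSize zero    (suc k) = refl
length-subsetsOfSize (suc n) (suc k) = begin
  length (map (inside ∷_) (subsetsOfSize n k) ++ map (outside ∷_) (subsetsOfSize n (suc k)))
    ≡⟨ length-++ (map (inside ∷_) (subsetsOfSize n k)) ⟩
  length (map (inside ∷_) (subsetsOfSize n k)) + length (map (outside ∷_) (subsetsOfSize n (suc k)))
    ≡⟨ cong₂ _+_ (length-map (inside ∷_) (subsetsOfSize n k)) (length-map (outside ∷_) (subsetsOfSize n (suc k))) ⟩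
  length (subsetsOfSize n k) + length (subsetsOfSize n (suc k))
    ≡⟨ cong₂ _+_ (length-subsetsOfSize n k) (length-subsetsOfSize n (suc k)) ⟩
  n C k + n C suc k
    ≡⟨ nCk+nC[k+1]≡[n+1]C[k+1] n k ⟩
  suc n C suc k
    ∎

sum-map-subsetsOfSize : ∀ n k (f : Subset (suc n) → ℕ) →
  sum (map f (subsetsOfSize (suc n) (suc k)))
    ≡ sum (map (f ∘ (inside ∷_)) (subsetsOfSize n k)) + sum (map (f ∘ (outside ∷_)) (subsetsOfSize n (suc k)))
sum-map-subsetsOfSize n k f = begin
  sum (map f (map (inside ∷_) (subsetsOfSize n k) ++ map (outside ∷_) (subsetsOfSize n (suc k))))
    ≡⟨ sum-map-++ f (map (inside ∷_) (subsetsOfSize n k)) _ ⟩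
  sum (map f (map (inside ∷_) (subsetsOfSize n k))) + sum (map f (map (outside ∷_) (subsetsOfSize n (suc k))))
    ≡⟨ cong₂ _+_ (cong sum (map-∘ (subsetsOfSize n k))) (cong sum (map-∘ (subsetsOfSize n (suc k)))) ⟨
  sum (map (f ∘ (inside ∷_)) (subsetsOfSize n k)) + sum (map (f ∘ (outside ∷_)) (subsetsOfSize n (suc k)))
    ∎

sum-⟦⊆X⟧ : ∀ n k (X : Subset n) → sum (map ⟦_⊆ X ⟧ (subsetsOfSize n k)) ≡ ∣ X ∣ C k
sum-⟦⊆X⟧ n       zero    X             = cong (_+ 0) (⟦⊥⊆X⟧≡1 X)
sum-⟦⊆X⟧ zero    (suc k) []            = refl
sum-⟦⊆X⟧ (suc n) (suc k) (inside ∷ X)  = begin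
  sum (map ⟦_⊆ inside ∷ X ⟧ (subsetsOfSize (suc n) (suc k)))
    ≡⟨ sum-map-subsetsOfSize n k ⟦_⊆ inside ∷ X ⟧ ⟩
  sum (map ⟦_⊆ X ⟧ (subsetsOfSize n k)) + sum (map ⟦_⊆ X ⟧ (subsetsOfSize n (suc k)))
    ≡⟨ cong₂ _+_ (sum-⟦⊆X⟧ n k X) (sum-⟦⊆X⟧ n (suc k) X) ⟩
  ∣ X ∣ C k + ∣ X ∣ C suc k
    ≡⟨ nCk+nC[k+1]≡[n+1]C[k+1] ∣ X ∣ k ⟩
  suc ∣ X ∣ C suc k
    ∎
sum-⟦⊆X⟧ (suc n) (suc k) (outside ∷ X) = begin
  sum (map ⟦_⊆ outside ∷ X ⟧ (subsetsOfSize (suc n) (suc k)))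
    ≡⟨ sum-map-subsetsOfSize n k ⟦_⊆ outside ∷ X ⟧ ⟩
  sum (map (λ _ → 0) (subsetsOfSize n k)) + sum (map ⟦_⊆ X ⟧ (subsetsOfSize n (suc k)))
    ≡⟨ cong₂ _+_ (sum-map-0 (subsetsOfSize n k)) (sum-⟦⊆X⟧ n (suc k) X) ⟩
  ∣ X ∣ C suc k
    ∎

gradedSubsets : ∀ n → ℕ → List (ℕ × Subset n)
gradedSubsets n zero    = []
gradedSubsets n (suc t) = gradedSubsets n t ++ map (t ,_) (subsetsOfSize n t)

length-gradedSubsets : ∀ n t → length (gradedSubsets n t) ≡ sumBinom< n t
length-gradedSubsets n zero    = refl
length-gradedSubsets n (suc t) = begin
  length (gradedSubsets n t ++ map (t ,_) (subsetsOfSize n t))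
    ≡⟨ length-++ (gradedSubsets n t) ⟩
  length (gradedSubsets n t) + length (map (t ,_) (subsetsOfSize n t))
    ≡⟨ cong₂ _+_ (length-gradedSubsets n t) (trans (length-map (t ,_) (subsetsOfSize n t)) (length-subsetsOfSize n t)) ⟩
  sumBinom< n t + n C t
    ∎

dot-gradedSubsets : ∀ n t (w : ℕ → ℕ) (E F : Subset n) →
  dot (gradedSubsets n t) (λ (j , S) → w j * ⟦ S ⊆ E ⟧) (λ (_ , S) → ⟦ S ⊆ F ⟧)
    ≡ sum (applyUpTo (λ j → (∣ E ∩ F ∣ C j) * w j) t)
dot-gradedSubsets n zero    w E F = refl
dot-gradedSubsets n (suc t) w E F = begin
  sum (map term (gradedSubsets n t ++ map (t ,_) (subsetsOfSize n t)))
    ≡⟨ sum-map-++ term (gradedSubsets n t) _ ⟩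
  sum (map term (gradedSubsets n t)) + sum (map term (map (t ,_) (subsetsOfSize n t)))
    ≡⟨ cong₂ _+_ (dot-gradedSubsets n t w E F) (cong sum (sym (map-∘ (subsetsOfSize n t)))) ⟩
  sum (applyUpTo g t) + sum (map (term ∘ (t ,_)) (subsetsOfSize n t))
    ≡⟨ cong (λ z → sum (applyUpTo g t) + sum z) (map-cong layer (subsetsOfSize n t)) ⟩
  sum (applyUpTo g t) + sum (map (λ S → w t * ⟦ S ⊆ E ∩ F ⟧) (subsetsOfSize n t))
    ≡⟨ cong (sum (applyUpTo g t) +_) (sum-map-* (w t) ⟦_⊆ E ∩ F ⟧ (subsetsOfSize n t)) ⟩
  sum (applyUpTo g t) + w t * sum (map ⟦_⊆ E ∩ F ⟧ (subsetsOfSize n t))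
    ≡⟨ cong (λ z → sum (applyUpTo g t) + w t * z) (sum-⟦⊆X⟧ n t (E ∩ F)) ⟩
  sum (applyUpTo g t) + w t * (∣ E ∩ F ∣ C t)
    ≡⟨ cong (sum (applyUpTo g t) +_) (*-comm (w t) _) ⟩
  sum (applyUpTo g t) + g t
    ≡⟨ sum-applyUpTo-∷ʳ g t ⟨
  sum (applyUpTo g (suc t))
    ∎
  where
  term : ℕ × Subset n → ℕ
  term (j , S) = w j * ⟦ S ⊆ E ⟧ * ⟦ S ⊆ F ⟧
  g : ℕ → ℕ
  g j = (∣ E ∩ F ∣ C j) * w j
  layer : ∀ S → term (t , S) ≡ w t * ⟦ S ⊆ E ∩ F ⟧
  layer S = trans (*-assoc (w t) ⟦ S ⊆ E ⟧ ⟦ S ⊆ F ⟧) (cong (w t *_) (⟦S⊆E⟧*⟦S⊆F⟧≡⟦S⊆E∩F⟧ S E F))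

unique⇒lookup-injective : ∀ {A : Set} {xs : List A} → Unique xs → ∀ i j → lookup xs i ≡ lookup xs j → i ≡ j
unique⇒lookup-injective (_ ∷ _)                     zero    zero    _  = refl
unique⇒lookup-injective {xs = _ ∷ xs} (x∉xs ∷ _)    zero    (suc j) eq =
  contradiction eq (All.lookup x∉xs (∈-lookup {xs = xs} j))
unique⇒lookup-injective {xs = _ ∷ xs} (x∉xs ∷ _)    (suc i) zero    eq =
  contradiction (sym eq) (All.lookup x∉xs (∈-lookup {xs = xs} i))
unique⇒lookup-injective               (_ ∷ unique) (suc i) (suc j) eq =
  cong suc (unique⇒lookup-injective unique i j eq)

module _ {p} (pp : Prime p) (α : ℕ) where

  private instance
    pᵅ≢0 : NonZero (p ^ α)
    pᵅ≢0 = m^n≢0 p α {{prime⇒nonZero pp}}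

  ∣E∩F∣≢∣E∣⇒length≤sumBinom< : ∀ {n} (𝓕 : List (Subset n)) → Unique 𝓕 →
    (∀ {E F} → E ∈ 𝓕 → F ∈ 𝓕 → E ≢ F → ¬ ∣ E ∩ F ∣ ≡[mod p ^ α ] ∣ E ∣) →
    length 𝓕 ≤ sumBinom< n (p ^ α)
  ∣E∩F∣≢∣E∣⇒length≤sumBinom< {n} 𝓕 unique ∩≢ =
    ≤-trans (biorthogonal⇒m≤length pp (gradedSubsets n (suc m)) biorthogonal)
            (≤-reflexive (trans (length-gradedSubsets n (suc m)) (cong (sumBinom< n) 1+m≡pᵅ)))
    where
    m = pred (p ^ α)
    1+m≡pᵅ : suc m ≡ p ^ α
    1+m≡pᵅ = suc-pred (p ^ α)
    F : Fin (length 𝓕) → Subset n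
    F = lookup 𝓕
    w : Fin (length 𝓕) → ℕ → ℕ
    w i l = offset m ∣ F i ∣ C (m ∸ l)
    a b : Fin (length 𝓕) → ℕ × Subset n → ℕ
    a i (l , S) = w i l * ⟦ S ⊆ F i ⟧
    b i (_ , S) = ⟦ S ⊆ F i ⟧
    dot≡ : ∀ i j → dot (gradedSubsets n (suc m)) (a i) (b j) ≡ (∣ F i ∩ F j ∣ + offset m ∣ F i ∣) C m
    dot≡ i j = trans (dot-gradedSubsets n (suc m) (w i) (F i) (F j)) (vandermonde ∣ F i ∩ F j ∣ (offset m ∣ F i ∣) m)
    criterion : ∀ x y → p ∣ (x + offset m y) C m ⇔ (¬ x ≡[mod suc m ] y)
    criterion = p∣[x+offset]Cm⇔x≢[mod]y pp α 1+m≡pᵅ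
    mod-pᵅ : ∀ {x y} → x ≡[mod suc m ] y → x ≡[mod p ^ α ] y
    mod-pᵅ x≡y = trans (%-congʳ (sym 1+m≡pᵅ)) (trans x≡y (%-congʳ 1+m≡pᵅ))
    biorthogonal : BiorthogonalMod p (gradedSubsets n (suc m)) a b
    biorthogonal = record
      { off-diagonal = λ {i} {j} i≢j → subst (p ∣_) (sym (dot≡ i j))
          (Equivalence.from (criterion ∣ F i ∩ F j ∣ ∣ F i ∣)
            (∩≢ (∈-lookup i) (∈-lookup j) (i≢j ∘ unique⇒lookup-injective unique i j) ∘ mod-pᵅ))
      ; diagonal     = λ i p∣D → Equivalence.to (criterion ∣ F i ∩ F i ∣ ∣ F i ∣)
          (subst (p ∣_) (dot≡ i i) p∣D) (cong (λ X → ∣ X ∣ % suc m) (∩-idem (F i)))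
      }

avoiding∧intersecting⇒∣E∩F∣≢∣E∣ : ∀ {n q} .{{_ : NonZero q}} {L} {𝓕 : List (Subset n)} →
  LAvoiding q L 𝓕 → LIntersecting q L 𝓕 →
  ∀ {E F} → E ∈ 𝓕 → F ∈ 𝓕 → E ≢ F → ¬ ∣ E ∩ F ∣ ≡[mod q ] ∣ E ∣
avoiding∧intersecting⇒∣E∩F∣≢∣E∣ avoid intersect {E} {F} E∈𝓕 F∈𝓕 E≢F ∣E∩F∣≡∣E∣
  with find (intersect E F E∈𝓕 F∈𝓕 E≢F)
... | ℓ , ℓ∈L , ∣E∩F∣≡ℓ = avoid E E∈𝓕 ℓ ℓ∈L (trans (sym ∣E∩F∣≡∣E∣) ∣E∩F∣≡ℓ)

corollary1p8 : (p α n s : ℕ) → (pp : Prime p) → α ≥ 1 → n ≥ 1 → s ≥ 1 →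
    m≤ n s (p ^ α) ⦃ m^n≢0 p α ⦃ prime⇒nonZero pp ⦄ ⦄ (sumBinom< n (p ^ α))
corollary1p8 p α n s pp _ _ _ L _ 𝓕 unique avoid intersect =
  ∣E∩F∣≢∣E∣⇒length≤sumBinom< pp α 𝓕 unique (avoiding∧intersecting⇒∣E∩F∣≢∣E∣ avoid intersect)
  where instance _ = m^n≢0 p α {{prime⇒nonZero pp}}
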